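{- Let $q$ be a prime power and let $\lambda=(a,1^m)$ be a hook, with $a>0$ and $m\geq 0$. Then, for a uniformly random ring homomorphism $\Lambda\to\mathbb{F}_q$, $P(s_\lambda\mapsto 0)=1/q$. Furthermore, $P(s_\lambda\mapsto c)=1/q$ for every $c\in\mathbb{F}_q$.
   Context: $\Lambda$ denotes the ring of symmetric functions over $\mathbb{Z}$, $h_k$ the complete homogeneous symmetric functions, and $s_\lambda$ the Schur function indexed by the partition $\lambda$. Since $\{h_k\}_{k\geq1}$ is an algebraically independent generating set of $\Lambda$, a ring homomorphism $\Lambda\to\mathbb{F}_q$ is determined by the images of $h_1,h_2,\dots$; a uniformly random homomorphism is obtained by sending the $h_k$ to independent uniformly random elements of $\mathbb{F}_q$ (only finitely many $h_k$ are involved in any given $s_\lambda$). $P(s_\lambda\mapsto c)$ denotes the probability that $s_\lambda$ is sent to $c\in\mathbb{F}_q$. The notation $(a,1^m)$ means the partition $(a,1,\dots,1)$ with $m$ ones. -}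

module Defs where

open import Level using (0ℓ)
open import Algebra.Bundles using (CommutativeRing)
open import Data.Nat as ℕ using (ℕ; zero; suc; _^_)
open import Data.Nat.Primality using (Prime)
open import Data.Integer as ℤ using (ℤ; +_; -[1+_])
open import Data.Fin using (Fin; zero; suc; toℕ; punchIn)
open import Data.Vec as Vec using (Vec; []; _∷_)
open import Data.List as List using (List; []; _∷_; length; filter; replicate; concatMap)
open import Data.Product using (∃; _×_)
open import Relation.Nullary using (¬_; yes; no)
open import Relation.Binary using (Decidable)
open import Relation.Binary.PropositionalEquality using (_≡_)

IsPrimePower : ℕ → Set
IsPrimePower q = ∃ λ p → ∃ λ k → Prime p × q ≡ p ^ suc k

record IsFiniteField (R : CommutativeRing 0ℓ 0ℓ) (q : ℕ) : Set where
  open CommutativeRing R hiding (zero)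
  field
    0≉1       : ¬ (0# ≈ 1#)
    inverse   : ∀ x → ¬ (x ≈ 0#) → ∃ λ y → x * y ≈ 1#
    _≟_       : Decidable _≈_
    enum      : Fin q → Carrier
    enum-inj  : ∀ i j → enum i ≈ enum j → i ≡ j
    enum-surj : ∀ x → ∃ λ i → enum i ≈ x

Partition : Set
Partition = List ℕ

hook : ℕ → ℕ → Partition
hook a m = a ∷ replicate m 1

allVecs : (q N : ℕ) → List (Vec (Fin q) N)
allVecs q zero = [] ∷ []
allVecs q (suc N) = concatMap (λ v → List.map (λ i → i ∷ v) (List.allFin q)) (allVecs q N)

module _ (R : CommutativeRing 0ℓ 0ℓ) where
  open CommutativeRing R hiding (zero)

  sumFin : ∀ n → (Fin n → Carrier) → Carrier
  sumFin zero f = 0#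
  sumFin (suc n) f = f zero + sumFin n (λ j → f (suc j))

  sign : ∀ {n} → Fin n → Carrier
  sign zero = 1#
  sign (suc j) = - sign j

  det : ∀ n → (Fin n → Fin n → Carrier) → Carrier
  det zero M = 1#
  det (suc n) M =
    sumFin (suc n) λ j → sign j * M zero j * det n (λ i k → M (suc i) (punchIn j k))

  -- h_k for k ∈ ℤ, with h_0 = 1 and h_k = 0 for k < 0;
  -- hpos k is the value of h_{k+1}.
  hℤ : (ℕ → Carrier) → ℤ → Carrier
  hℤ hpos (+ zero) = 1#
  hℤ hpos (+ suc k) = hpos k
  hℤ hpos -[1+ k ] = 0#

  -- image of the Schur function s_λ under the homomorphism h_{k+1} ↦ hpos k,
  -- via the Jacobi–Trudi identity s_λ = det (h_{λ_i - i + j})_{1≤i,j≤ℓ(λ)}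
  schur : Partition → (ℕ → Carrier) → Carrier
  schur p hpos = det (length p) (λ i j →
    hℤ hpos ((+ List.lookup p i ℤ.- + toℕ i) ℤ.+ + toℕ j))

module _ (R : CommutativeRing 0ℓ 0ℓ) {q : ℕ} (F : IsFiniteField R q) where
  open CommutativeRing R hiding (zero)
  open IsFiniteField F

  -- the homomorphism Λ → F_q determined by h_1,…,h_N ↦ enum (v_1),…,enum (v_N)
  -- (h_k for k > N are irrelevant when N is large enough; set to 0)
  hFromVec : ∀ {N} → Vec (Fin q) N → ℕ → Carrier
  hFromVec [] k = 0#
  hFromVec (x ∷ v) zero = enum x
  hFromVec (x ∷ v) (suc k) = hFromVec v k

  count : Partition → (N : ℕ) → Carrier → ℕ
  count p N c = length (filter (λ v → schur R p (hFromVec v) ≟ c) (allVecs q N))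

-- By Jacobi–Trudi, s_(a,1^m) is the determinant of the (m+1)×(m+1) matrix whose first row is
-- h_a, …, h_(a+m) and whose lower rows (h_(j-i+1)) vanish below the subdiagonal, where they are
-- h_0 = 1. Expanding along the first row, the cofactor of h_(a+m) is unitriangular, so
-- s_λ = D ± h_(a+m) with D a polynomial in h_1, …, h_(a+m-1) alone. Whatever values the other h_k
-- take, exactly one value of h_(a+m) therefore sends s_λ to c, so s_λ ↦ c for q^(N-1) of the q^N
-- assignments of h_1, …, h_N.

module Submission where

open import Defs
open import Level using (0ℓ)
open import Algebra.Bundles using (CommutativeRing)
open import Data.Nat as Nat using (ℕ; zero; suc; _^_; _≤_; _<_; _>_)
open import Data.Product using (_×_)
open import Relation.Binary.PropositionalEquality using (_≡_)

open import Data.Bool.Base using (true; false; if_then_else_)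
open import Data.Fin.Base using (Fin; zero; suc; toℕ; punchIn; inject₁; fromℕ)
open import Data.Fin.Properties using (punchInᵢ≢i)
open import Data.List.Base as List using (List; []; _∷_; map; filter; concatMap; length)
open import Data.List.Properties using (map-++; map-cong; map-∘; map-tabulate)
open import Data.Product using (∃!; _,_; proj₁; proj₂)
open import Data.Vec.Base using (Vec; _∷_; insertAt)
open import Function.Base using (_∘_)
import Relation.Binary.PropositionalEquality as ≡
open import Relation.Nullary using (¬_; does)
open import Relation.Nullary.Decidable using (dec-true; dec-false)
open import Relation.Unary using (Pred; Decidable)

module Counting where
  open Nat using (_+_; _*_)
  open import Data.Nat.Properties using (+-0-commutativeMonoid; *-assoc; *-comm; *-identityʳ)
  open import Data.Nat.ListAction using (sum)
  open import Data.Nat.ListAction.Properties using (sum-++)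
  open ≡ using (refl; sym; trans; cong; cong₂)
  open ≡.≡-Reasoning
  open import Algebra.Properties.CommutativeMonoid.Sum +-0-commutativeMonoid
    using (sum-syntax; ∑-comm; sum-cong-≗; sum-remove; sum-replicate-zero)

  indicator : ∀ {a p} {A : Set a} {P : Pred A p} → Decidable P → A → ℕ
  indicator P? x = if does (P? x) then 1 else 0

  module _ {a p} {A : Set a} {P : Pred A p} (P? : Decidable P) where

    length-filter≡sum-indicator : (xs : List A) → length (filter P? xs) ≡ sum (map (indicator P?) xs)
    length-filter≡sum-indicator []       = refl
    length-filter≡sum-indicator (x ∷ xs) with does (P? x)
    ... | true  = cong suc (length-filter≡sum-indicator xs)
    ... | false = length-filter≡sum-indicator xs

    indicator-yes : ∀ {x} → P x → indicator P? x ≡ 1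
    indicator-yes {x} px = cong (if_then 1 else 0) (dec-true (P? x) px)

    indicator-no : ∀ {x} → ¬ P x → indicator P? x ≡ 0
    indicator-no {x} ¬px = cong (if_then 1 else 0) (dec-false (P? x) ¬px)

  ∑-indicator-∃! : ∀ {n p} {P : Pred (Fin n) p} (P? : Decidable P) → ∃! _≡_ P →
                   ∑[ i < n ] indicator P? i ≡ 1
  ∑-indicator-∃! {suc n} P? (x , px , unique) = begin
    ∑[ i < suc n ] indicator P? i                          ≡⟨ sum-remove {i = x} (indicator P?) ⟩
    indicator P? x + ∑[ j < n ] indicator P? (punchIn x j) ≡⟨ cong₂ _+_ (indicator-yes P? px) others≡0 ⟩
    1 + 0                                                  ∎
    where
    others≡0 : ∑[ j < n ] indicator P? (punchIn x j) ≡ 0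
    others≡0 = trans (sum-cong-≗ (λ j → indicator-no P? (punchInᵢ≢i x j ∘ sym ∘ unique)))
                     (sum-replicate-zero n)

  ∑-const : ∀ n c → ∑[ i < n ] c ≡ n * c
  ∑-const zero    c = refl
  ∑-const (suc n) c = cong (c +_) (∑-const n c)

  sum-tabulate : ∀ {n} (f : Fin n → ℕ) → sum (List.tabulate f) ≡ ∑[ i < n ] f i
  sum-tabulate {zero}  f = refl
  sum-tabulate {suc n} f = cong (f zero +_) (sum-tabulate (f ∘ suc))

  sum-map-allFin : ∀ {n} (f : Fin n → ℕ) → sum (map f (List.allFin n)) ≡ ∑[ i < n ] f i
  sum-map-allFin f = trans (cong sum (map-tabulate (λ i → i) f)) (sum-tabulate f)

  sum-map-concatMap : ∀ {a b} {A : Set a} {B : Set b} (f : B → ℕ) (g : A → List B) (xs : List A) →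
                      sum (map f (concatMap g xs)) ≡ sum (map (sum ∘ map f ∘ g) xs)
  sum-map-concatMap f g []       = refl
  sum-map-concatMap f g (x ∷ xs) = begin
    sum (map f (g x List.++ concatMap g xs))            ≡⟨ cong sum (map-++ f (g x) _) ⟩
    sum (map f (g x) List.++ map f (concatMap g xs))    ≡⟨ sum-++ (map f (g x)) _ ⟩
    sum (map f (g x)) + sum (map f (concatMap g xs))    ≡⟨ cong (sum (map f (g x)) +_) (sum-map-concatMap f g xs) ⟩
    sum (map f (g x)) + sum (map (sum ∘ map f ∘ g) xs)  ∎

  module _ (q : ℕ) where

    sum-allVecs-suc : ∀ N (f : Vec (Fin q) (suc N) → ℕ) →
      sum (map f (allVecs q (suc N))) ≡ sum (map (λ v → ∑[ i < q ] f (i ∷ v)) (allVecs q N))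
    sum-allVecs-suc N f =
      trans (sum-map-concatMap f _ (allVecs q N)) (cong sum (map-cong inner (allVecs q N)))
      where
      inner : ∀ v → sum (map f (map (_∷ v) (List.allFin q))) ≡ ∑[ i < q ] f (i ∷ v)
      inner v = trans (cong sum (sym (map-∘ (List.allFin q)))) (sum-map-allFin (λ i → f (i ∷ v)))

    ^-*-shift : ∀ N c → q ^ N * (q * c) ≡ q ^ suc N * c
    ^-*-shift N c = trans (sym (*-assoc (q ^ N) q c)) (cong (_* c) (*-comm (q ^ N) q))

    sum-allVecs-const : ∀ N c → sum (map (λ _ → c) (allVecs q N)) ≡ q ^ N * c
    sum-allVecs-const zero    c = refl
    sum-allVecs-const (suc N) c = begin
      sum (map (λ _ → c) (allVecs q (suc N)))      ≡⟨ sum-allVecs-suc N (λ _ → c) ⟩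
      sum (map (λ _ → ∑[ i < q ] c) (allVecs q N)) ≡⟨ cong sum (map-cong (λ _ → ∑-const q c) (allVecs q N)) ⟩
      sum (map (λ _ → q * c) (allVecs q N))        ≡⟨ sum-allVecs-const N (q * c) ⟩
      q ^ N * (q * c)                              ≡⟨ ^-*-shift N c ⟩
      q ^ suc N * c                                ∎

    sum-allVecs-insertAt : ∀ n (k : Fin (suc n)) (f : Vec (Fin q) (suc n) → ℕ) c →
      (∀ w → ∑[ x < q ] f (insertAt w k x) ≡ c) → sum (map f (allVecs q (suc n))) ≡ q ^ n * c
    sum-allVecs-insertAt n zero f c fibre = begin
      sum (map f (allVecs q (suc n)))                       ≡⟨ sum-allVecs-suc n f ⟩
      sum (map (λ w → ∑[ x < q ] f (x ∷ w)) (allVecs q n))  ≡⟨ cong sum (map-cong fibre (allVecs q n)) ⟩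
      sum (map (λ _ → c) (allVecs q n))                     ≡⟨ sum-allVecs-const n c ⟩
      q ^ n * c                                             ∎
    -- Sum out the head first; each fibre of the result through k is a double sum over the head
    -- and the inserted coordinate, whose order ∑-comm exchanges.
    sum-allVecs-insertAt (suc n) (suc k) f c fibre = begin
      sum (map f (allVecs q (suc (suc n))))                       ≡⟨ sum-allVecs-suc (suc n) f ⟩
      sum (map (λ v → ∑[ i < q ] f (i ∷ v)) (allVecs q (suc n)))
        ≡⟨ sum-allVecs-insertAt n k (λ v → ∑[ i < q ] f (i ∷ v)) (q * c) fibre′ ⟩
      q ^ n * (q * c)                                             ≡⟨ ^-*-shift n c ⟩
      q ^ suc n * c                                               ∎
      where
      fibre′ : ∀ w → ∑[ x < q ] ∑[ i < q ] f (i ∷ insertAt w k x) ≡ q * c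
      fibre′ w = begin
        ∑[ x < q ] ∑[ i < q ] f (i ∷ insertAt w k x)          ≡⟨ ∑-comm (λ x i → f (i ∷ insertAt w k x)) ⟩
        ∑[ i < q ] ∑[ x < q ] f (insertAt (i ∷ w) (suc k) x)  ≡⟨ sum-cong-≗ (λ i → fibre (i ∷ w)) ⟩
        ∑[ i < q ] c                                          ≡⟨ ∑-const q c ⟩
        q * c                                                 ∎

    length-filter-allVecs : ∀ n (k : Fin (suc n)) {p} {P : Pred (Vec (Fin q) (suc n)) p} (P? : Decidable P) →
      (∀ w → ∃! _≡_ (λ x → P (insertAt w k x))) → length (filter P? (allVecs q (suc n))) ≡ q ^ n
    length-filter-allVecs n k P? unique = begin
      length (filter P? (allVecs q (suc n)))       ≡⟨ length-filter≡sum-indicator P? (allVecs q (suc n)) ⟩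
      sum (map (indicator P?) (allVecs q (suc n))) ≡⟨ sum-allVecs-insertAt n k (indicator P?) 1 fibre ⟩
      q ^ n * 1                                    ≡⟨ *-identityʳ (q ^ n) ⟩
      q ^ n                                        ∎
      where
      fibre : ∀ w → ∑[ x < q ] indicator P? (insertAt w k x) ≡ 1
      fibre w = ∑-indicator-∃! (P? ∘ insertAt w k) (unique w)

module Determinant (R : CommutativeRing 0ℓ 0ℓ) where
  open CommutativeRing R hiding (zero)
  open import Algebra.Properties.Monoid.Sum +-monoid using (sum; sum-cong-≋; sum-replicate-zero; sum-init-last)
  open import Relation.Binary.Reasoning.Setoid setoid
  open import Algebra.Properties.Ring ring using (-‿distribˡ-*; -‿distribʳ-*; -‿involutive)

  Matrix : ℕ → Set
  Matrix n = Fin n → Fin n → Carrier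

  sumFin≡sum : ∀ n (f : Fin n → Carrier) → sumFin R n f ≡ sum f
  sumFin≡sum zero    f = ≡.refl
  sumFin≡sum (suc n) f = ≡.cong (f zero +_) (sumFin≡sum n (f ∘ suc))

  sumFin-cong : ∀ n {f g : Fin n → Carrier} → (∀ j → f j ≈ g j) → sumFin R n f ≈ sumFin R n g
  sumFin-cong n {f} {g} f≈g = begin
    sumFin R n f  ≡⟨ sumFin≡sum n f ⟩
    sum f         ≈⟨ sum-cong-≋ f≈g ⟩
    sum g         ≡⟨ sumFin≡sum n g ⟨
    sumFin R n g  ∎

  sumFin≈0 : ∀ n {f : Fin n → Carrier} → (∀ j → f j ≈ 0#) → sumFin R n f ≈ 0#
  sumFin≈0 n f≈0 = trans (sumFin-cong n f≈0)
                          (trans (reflexive (sumFin≡sum n (λ _ → 0#))) (sum-replicate-zero n))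

  minor : ∀ {n} → Matrix (suc n) → Fin (suc n) → Matrix n
  minor M j i k = M (suc i) (punchIn j k)

  laplaceTerm : ∀ {n} → Matrix (suc n) → Fin (suc n) → Carrier
  laplaceTerm {n} M j = sign R j * M zero j * det R n (minor M j)

  record UpperUnitriangular {n} (T : Matrix n) : Set where
    field
      lower≈0    : ∀ i k → toℕ k < toℕ i → T i k ≈ 0#
      diagonal≈1 : ∀ i → T i i ≈ 1#

  det-cong : ∀ n {M M′ : Matrix n} → (∀ i j → M i j ≈ M′ i j) → det R n M ≈ det R n M′
  det-cong zero    M≈M′ = refl
  det-cong (suc n) M≈M′ = sumFin-cong (suc n) λ j →
    *-cong (*-congˡ {sign R j} (M≈M′ zero j)) (det-cong n (λ i k → M≈M′ (suc i) (punchIn j k)))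

  det-firstColumn≈0 : ∀ {n} (M : Matrix (suc n)) → (∀ i → M i zero ≈ 0#) → det R (suc n) M ≈ 0#
  det-minor≈0 : ∀ {n} (M : Matrix (suc n)) → (∀ i → M (suc i) zero ≈ 0#) →
                (j : Fin n) → det R n (minor M (suc j)) ≈ 0#

  det-firstColumn≈0 {n} M col≈0 = sumFin≈0 (suc n) term≈0
    where
    term≈0 : ∀ j → laplaceTerm M j ≈ 0#
    term≈0 zero    = trans (*-congʳ (trans (*-congˡ (col≈0 zero)) (zeroʳ _))) (zeroˡ _)
    term≈0 (suc j) = trans (*-congˡ (det-minor≈0 M (col≈0 ∘ suc) j)) (zeroʳ _)

  det-minor≈0 {suc n} M col≈0 j = det-firstColumn≈0 (minor M (suc j)) col≈0

  det-upperUnitriangular : ∀ {n} (T : Matrix n) → UpperUnitriangular T → det R n T ≈ 1#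
  det-upperUnitriangular {zero}  T _  = refl
  det-upperUnitriangular {suc n} T ut = begin
    laplaceTerm T zero + sumFin R n (laplaceTerm T ∘ suc) ≈⟨ +-cong leading≈1 (sumFin≈0 n others≈0) ⟩
    1# + 0#                                               ≈⟨ +-identityʳ 1# ⟩
    1#                                                    ∎
    where
    open UpperUnitriangular ut
    minor-ut : UpperUnitriangular (minor T zero)
    minor-ut = record
      { lower≈0    = λ i k k<i → lower≈0 (suc i) (suc k) (Nat.s<s k<i)
      ; diagonal≈1 = diagonal≈1 ∘ suc
      }
    leading≈1 : laplaceTerm T zero ≈ 1#
    leading≈1 = trans (*-cong (trans (*-identityˡ _) (diagonal≈1 zero)) (det-upperUnitriangular _ minor-ut))
                      (*-identityˡ 1#)
    others≈0 : ∀ j → laplaceTerm T (suc j) ≈ 0#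
    others≈0 j = trans (*-congˡ (det-minor≈0 T (λ i → lower≈0 (suc i) zero Nat.z<s) j)) (zeroʳ _)

  punchIn-fromℕ : ∀ n (k : Fin n) → punchIn (fromℕ n) k ≡ inject₁ k
  punchIn-fromℕ (suc n) zero    = ≡.refl
  punchIn-fromℕ (suc n) (suc k) = ≡.cong suc (punchIn-fromℕ n k)

  laplaceInit : ∀ {n} → Matrix (suc n) → Carrier
  laplaceInit {n} M = sumFin R n (laplaceTerm M ∘ inject₁)

  det≈laplaceInit+last : ∀ {n} (M : Matrix (suc n)) → UpperUnitriangular (λ i k → M (suc i) (inject₁ k)) →
                         det R (suc n) M ≈ laplaceInit M + sign R (fromℕ n) * M zero (fromℕ n)
  det≈laplaceInit+last {n} M ut = begin
    det R (suc n) M                                         ≡⟨ sumFin≡sum (suc n) (laplaceTerm M) ⟩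
    sum (laplaceTerm M)                                     ≈⟨ sum-init-last (laplaceTerm M) ⟩
    sum (laplaceTerm M ∘ inject₁) + laplaceTerm M (fromℕ n) ≡⟨ ≡.cong (_+ laplaceTerm M (fromℕ n)) (sumFin≡sum n _) ⟨
    laplaceInit M + laplaceTerm M (fromℕ n)                 ≈⟨ +-congˡ (trans (*-congˡ lastMinor≈1) (*-identityʳ _)) ⟩
    laplaceInit M + sign R (fromℕ n) * M zero (fromℕ n)     ∎
    where
    lastMinor≈1 : det R n (minor M (fromℕ n)) ≈ 1#
    lastMinor≈1 = trans (det-cong n (λ i k → reflexive (≡.cong (M (suc i)) (punchIn-fromℕ n k))))
                        (det-upperUnitriangular _ ut)

  laplaceInit-cong : ∀ {n} {M M′ : Matrix (suc n)} → (∀ i j → M (suc i) j ≈ M′ (suc i) j) →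
                     (∀ j → M zero (inject₁ j) ≈ M′ zero (inject₁ j)) → laplaceInit M ≈ laplaceInit M′
  laplaceInit-cong {n} lower≈ first≈ = sumFin-cong n λ j →
    *-cong (*-congˡ {sign R (inject₁ j)} (first≈ j)) (det-cong n (λ i k → lower≈ i _))

  sign*sign≈1 : ∀ {n} (j : Fin n) → sign R j * sign R j ≈ 1#
  sign*sign≈1 zero    = *-identityˡ 1#
  sign*sign≈1 (suc j) = begin
    - sign R j * - sign R j     ≈⟨ -‿distribˡ-* _ _ ⟨
    - (sign R j * - sign R j)   ≈⟨ -‿cong (-‿distribʳ-* _ _) ⟨
    - - (sign R j * sign R j)   ≈⟨ -‿involutive _ ⟩
    sign R j * sign R j         ≈⟨ sign*sign≈1 j ⟩
    1#                          ∎

module JacobiTrudi (R : CommutativeRing 0ℓ 0ℓ) where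
  open CommutativeRing R hiding (zero)
  open Determinant R
  open import Relation.Binary.Reasoning.Setoid setoid
  open import Data.Integer.Base as ℤ using (+_; _⊖_)
  open import Data.Integer.Properties using ([1+m]⊖[1+n]≡m⊖n; n⊖n≡0)
  import Data.Nat.Properties as Natₚ
  open Natₚ using (n<1+n; m<n⇒m<1+n; <-≤-trans; ≤-trans; m≤n+m; +-monoʳ-<)
  open import Data.Fin.Properties using (toℕ-inject₁; toℕ-fromℕ; toℕ≤pred[n]; inject₁ℕ<)

  hℤ-⊖-< : ∀ hv {s t} → s < t → hℤ R hv (s ⊖ t) ≡ 0#
  hℤ-⊖-< hv {zero}  {suc t} _          = ≡.refl
  hℤ-⊖-< hv {suc s} {suc t} (Nat.s<s s<t) =
    ≡.trans (≡.cong (hℤ R hv) ([1+m]⊖[1+n]≡m⊖n s t)) (hℤ-⊖-< hv s<t)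

  hℤ-⊖-self : ∀ hv s → hℤ R hv (s ⊖ s) ≡ 1#
  hℤ-⊖-self hv s = ≡.cong (hℤ R hv) (n⊖n≡0 s)

  hℤ-⊖-local : ∀ {hv hv′} s t → (∀ u → u < s → hv u ≈ hv′ u) → hℤ R hv (s ⊖ t) ≈ hℤ R hv′ (s ⊖ t)
  hℤ-⊖-local zero    zero    _     = refl
  hℤ-⊖-local zero    (suc t) _     = refl
  hℤ-⊖-local (suc s) zero    agree = agree s (n<1+n s)
  hℤ-⊖-local (suc s) (suc t) agree rewrite [1+m]⊖[1+n]≡m⊖n s t =
    hℤ-⊖-local s t (λ u u<s → agree u (m<n⇒m<1+n u<s))

  -- The matrix inside Defs.schur: schur R p hv is definitionally det R (length p) (jacobiTrudi p hv).
  jacobiTrudi : (p : Partition) → (ℕ → Carrier) → Matrix (length p)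
  jacobiTrudi p hv i j = hℤ R hv ((+ List.lookup p i ℤ.- + toℕ i) ℤ.+ + toℕ j)

  lookup-replicate′ : ∀ {a} {A : Set a} n (x : A) (i : Fin (length (List.replicate n x))) →
                      List.lookup (List.replicate n x) i ≡ x
  lookup-replicate′ (suc n) x zero    = ≡.refl
  lookup-replicate′ (suc n) x (suc i) = lookup-replicate′ n x i

  1-[1+t]+s≡s⊖t : ∀ s t → (+ 1 ℤ.- + suc t) ℤ.+ + s ≡ s ⊖ t
  1-[1+t]+s≡s⊖t s zero    = ≡.refl
  1-[1+t]+s≡s⊖t s (suc t) = ≡.refl

  module _ (a m : ℕ) where
    private
      L : ℕ
      L = length (List.replicate m 1)
      JT : (ℕ → Carrier) → Matrix (suc L)
      JT = jacobiTrudi (hook (suc a) m)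

    jacobiTrudi-hook-row₀ : ∀ hv j → JT hv zero j ≡ hv (a Nat.+ toℕ j)
    jacobiTrudi-hook-row₀ hv j = ≡.cong (λ b → hv (b Nat.+ toℕ j)) (Natₚ.+-identityʳ a)

    jacobiTrudi-hook-row : ∀ hv i j → JT hv (suc i) j ≡ hℤ R hv (toℕ j ⊖ toℕ i)
    jacobiTrudi-hook-row hv i j rewrite lookup-replicate′ m 1 i =
      ≡.cong (hℤ R hv) (1-[1+t]+s≡s⊖t (toℕ j) (toℕ i))

    jacobiTrudi-hook-lowerRows : ∀ hv → UpperUnitriangular (λ i k → JT hv (suc i) (inject₁ k))
    jacobiTrudi-hook-lowerRows hv = record
      { lower≈0    = λ i k k<i → reflexive (≡.trans (entry i k) (hℤ-⊖-< hv k<i))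
      ; diagonal≈1 = λ i → reflexive (≡.trans (entry i i) (hℤ-⊖-self hv (toℕ i)))
      }
      where
      entry : ∀ i k → JT hv (suc i) (inject₁ k) ≡ hℤ R hv (toℕ k ⊖ toℕ i)
      entry i k = ≡.trans (jacobiTrudi-hook-row hv i (inject₁ k))
                          (≡.cong (λ s → hℤ R hv (s ⊖ toℕ i)) (toℕ-inject₁ k))

    schur-hook : ∀ hv → schur R (hook (suc a) m) hv ≈ laplaceInit (JT hv) + sign R (fromℕ L) * hv (a Nat.+ L)
    schur-hook hv = trans (det≈laplaceInit+last (JT hv) (jacobiTrudi-hook-lowerRows hv))
                          (+-congˡ (*-congˡ (reflexive lastEntry)))
      where
      lastEntry : JT hv zero (fromℕ L) ≡ hv (a Nat.+ L)
      lastEntry = ≡.trans (jacobiTrudi-hook-row₀ hv (fromℕ L)) (≡.cong (λ t → hv (a Nat.+ t)) (toℕ-fromℕ L))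

    laplaceInit-hook-local : ∀ {hv hv′} → (∀ u → u < a Nat.+ L → hv u ≈ hv′ u) →
                             laplaceInit (JT hv) ≈ laplaceInit (JT hv′)
    laplaceInit-hook-local {hv} {hv′} agree = laplaceInit-cong {M = JT hv} {JT hv′} lowerRows≈ firstRow≈
      where
      lowerRows≈ : ∀ i j → JT hv (suc i) j ≈ JT hv′ (suc i) j
      lowerRows≈ i j = begin
        JT hv (suc i) j             ≡⟨ jacobiTrudi-hook-row hv i j ⟩
        hℤ R hv (toℕ j ⊖ toℕ i)     ≈⟨ hℤ-⊖-local (toℕ j) (toℕ i) (λ u u<j → agree u (<-≤-trans u<j j≤a+L)) ⟩
        hℤ R hv′ (toℕ j ⊖ toℕ i)    ≡⟨ jacobiTrudi-hook-row hv′ i j ⟨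
        JT hv′ (suc i) j            ∎
        where
        j≤a+L : toℕ j ≤ a Nat.+ L
        j≤a+L = ≤-trans (toℕ≤pred[n] j) (m≤n+m L a)
      firstRow≈ : ∀ j → JT hv zero (inject₁ j) ≈ JT hv′ zero (inject₁ j)
      firstRow≈ j = begin
        JT hv zero (inject₁ j)            ≡⟨ jacobiTrudi-hook-row₀ hv (inject₁ j) ⟩
        hv (a Nat.+ toℕ (inject₁ j))      ≈⟨ agree _ (+-monoʳ-< a (inject₁ℕ< j)) ⟩
        hv′ (a Nat.+ toℕ (inject₁ j))     ≡⟨ jacobiTrudi-hook-row₀ hv′ (inject₁ j) ⟨
        JT hv′ zero (inject₁ j)           ∎

module HookCount (R : CommutativeRing 0ℓ 0ℓ) {q : ℕ} (F : IsFiniteField R q) where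
  open CommutativeRing R hiding (zero)
  open IsFiniteField F
  open Determinant R using (laplaceInit; sign*sign≈1)
  open JacobiTrudi R
  open Counting using (length-filter-allVecs)
  open import Relation.Binary.Reasoning.Setoid setoid
  open import Algebra.Properties.Monoid *-monoid using (cancelˡ)
  open import Algebra.Properties.Group +-group using (\\-leftDividesˡ; \\-leftDividesʳ)
  open import Data.Fin.Base using (fromℕ<)
  open import Data.Fin.Properties using (toℕ-fromℕ<)
  open import Data.List.Properties using (length-replicate)

  hFromVec-insertAt : ∀ {n} (w : Vec (Fin q) n) k x → hFromVec R F (insertAt w k x) (toℕ k) ≡ enum x
  hFromVec-insertAt w       zero    x = ≡.refl
  hFromVec-insertAt (y ∷ w) (suc k) x = hFromVec-insertAt w k x

  hFromVec-insertAt-below : ∀ {n} (w : Vec (Fin q) n) k x {t} → t < toℕ k →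
                            hFromVec R F (insertAt w k x) t ≡ hFromVec R F w t
  hFromVec-insertAt-below (y ∷ w) (suc k) x {zero}  _              = ≡.refl
  hFromVec-insertAt-below (y ∷ w) (suc k) x {suc t} (Nat.s<s t<k) = hFromVec-insertAt-below w k x t<k

  ∃!-affine-preimage : ∀ {u v d} → v * u ≈ 1# → (g : Fin q → Carrier) → (∀ x → g x ≈ d + u * enum x) →
                       ∀ c → ∃! _≡_ (λ x → g x ≈ c)
  ∃!-affine-preimage {u} {v} {d} v*u≈1 g affine c =
    x , gx≈c , λ {y} gy≈c → enum-inj x y (trans enum-x (sym (solve gy≈c)))
    where
    u*v≈1 : u * v ≈ 1#
    u*v≈1 = trans (*-comm u v) v*u≈1
    solution : Carrier
    solution = v * (- d + c)
    x : Fin q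
    x = proj₁ (enum-surj solution)
    enum-x : enum x ≈ solution
    enum-x = proj₂ (enum-surj solution)
    gx≈c : g x ≈ c
    gx≈c = begin
      g x                      ≈⟨ affine x ⟩
      d + u * enum x           ≈⟨ +-congˡ (*-congˡ enum-x) ⟩
      d + u * (v * (- d + c))  ≈⟨ +-congˡ (cancelˡ u*v≈1 _) ⟩
      d + (- d + c)            ≈⟨ \\-leftDividesˡ d c ⟩
      c                        ∎
    solve : ∀ {y} → g y ≈ c → enum y ≈ solution
    solve {y} gy≈c = begin
      enum y                        ≈⟨ cancelˡ v*u≈1 _ ⟨
      v * (u * enum y)              ≈⟨ *-congˡ (\\-leftDividesʳ d _) ⟨
      v * (- d + (d + u * enum y))  ≈⟨ *-congˡ (+-congˡ (trans (sym (affine y)) gy≈c)) ⟩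
      v * (- d + c)                 ∎

  module _ (a m : ℕ) {n} (k : Fin (suc n)) (k≡a+L : toℕ k ≡ a Nat.+ length (List.replicate m 1)) where
    private
      L : ℕ
      L = length (List.replicate m 1)

    schur-hook-insertAt : ∀ w x → schur R (hook (suc a) m) (hFromVec R F (insertAt w k x))
                          ≈ laplaceInit (jacobiTrudi (hook (suc a) m) (hFromVec R F w)) + sign R (fromℕ L) * enum x
    schur-hook-insertAt w x = begin
      schur R (hook (suc a) m) hv                                                     ≈⟨ schur-hook a m hv ⟩
      laplaceInit (jacobiTrudi (hook (suc a) m) hv) + sign R (fromℕ L) * hv (a Nat.+ L)
        ≈⟨ +-cong (laplaceInit-hook-local a m below) (*-congˡ (reflexive at)) ⟩
      laplaceInit (jacobiTrudi (hook (suc a) m) (hFromVec R F w)) + sign R (fromℕ L) * enum x ∎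
      where
      hv : ℕ → Carrier
      hv = hFromVec R F (insertAt w k x)
      below : ∀ u → u < a Nat.+ L → hv u ≈ hFromVec R F w u
      below u u<a+L = reflexive (hFromVec-insertAt-below w k x (≡.subst (u <_) (≡.sym k≡a+L) u<a+L))
      at : hv (a Nat.+ L) ≡ enum x
      at = ≡.subst (λ t → hv t ≡ enum x) k≡a+L (hFromVec-insertAt w k x)

  count-hook : ∀ a m n → a Nat.+ m ≤ n → ∀ c → count R F (hook (suc a) m) (suc n) c ≡ q ^ n
  count-hook a m n a+m≤n c =
    length-filter-allVecs q n k (λ v → schur R (hook (suc a) m) (hFromVec R F v) ≟ c) λ w →
      ∃!-affine-preimage (sign*sign≈1 (fromℕ L)) _ (schur-hook-insertAt a m k (toℕ-fromℕ< a+L<1+n) w) c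
    where
    L : ℕ
    L = length (List.replicate m 1)
    a+L<1+n : a Nat.+ L < suc n
    a+L<1+n = Nat.s≤s (≡.subst (λ l → a Nat.+ l ≤ n) (≡.sym (length-replicate m)) a+m≤n)
    k : Fin (suc n)
    k = fromℕ< a+L<1+n

open Nat using (_+_; _*_)
open import Data.Nat.Properties using (*-comm)

proposition3p1 : (q : ℕ) → IsPrimePower q →
    (R : CommutativeRing 0ℓ 0ℓ) → (F : IsFiniteField R q) →
    (a m : ℕ) → a > 0 → (N : ℕ) → a + m ≤ N →
    (count R F (hook a m) N (CommutativeRing.0# R) * q ≡ q ^ N)
    × ((c : CommutativeRing.Carrier R) → count R F (hook a m) N c * q ≡ q ^ N)
proposition3p1 q _ R F (suc a) m Nat.z<s (suc n) (Nat.s≤s a+m≤n) =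
  count*q≡q^N (CommutativeRing.0# R) , count*q≡q^N
  where
  count*q≡q^N : ∀ c → count R F (hook (suc a) m) (suc n) c * q ≡ q ^ suc n
  count*q≡q^N c = ≡.trans (≡.cong (_* q) (HookCount.count-hook R F a m n a+m≤n c)) (*-comm (q ^ n) q)
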